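{- Let $\mathbb{C}$ be a ribbon category and $A$ a reflexive object with isomorphism $\varphi:A\otimes A^*\to A$. For every morphism $f:A\otimes B\to A\otimes C$, $(\mathbf{lam}\otimes B);(A\otimes f);(\mathbf{app}\otimes C)=A\otimes\mathrm{Tr}_L{}^A_{B,C}(f):A\otimes B\to A\otimes C$, where the left trace is $\mathrm{Tr}_L{}^X_{B,C}(f):=\mathrm{Tr}^X_{B,C}(\sigma^{ -1}_{X,B};f;\sigma_{X,C})$ for $f:X\otimes B\to X\otimes C$.
   Context: Ribbon category: a (strict) braided monoidal category with braid $\sigma_{X,Y}:X\otimes Y\to Y\otimes X$, natural twist isomorphism $\theta$ with $\theta_{X\otimes Y}=\sigma_{X,Y};(\theta_Y\otimes\theta_X);\sigma_{Y,X}$, every object $X$ having a chosen left dual $X^*$ with unit $\eta_X:I\to X\otimes X^*$, counit $\varepsilon_X:X^*\otimes X\to I$ satisfying the snake equations, and $(\theta_X)^*=\theta_{X^*}$; composition $f;g$ is diagrammatic ($f$ first). Trace: $\mathrm{Tr}^X_{U,V}(g)=(U\otimes\eta_X);(g\otimes X^*);(V\otimes(\sigma_{X,X^*};(X^*\otimes\theta_X);\varepsilon_X))$ for $g:U\otimes X\to V\otimes X$. A reflexive object is an object $A$ with an isomorphism $\varphi:A\otimes A^*\to A$. $\mathbf{app}:=(\varphi^{ -1}\otimes A);(A\otimes\varepsilon_A):A\otimes A\to A$; $\mathbf{lam}:=(A\otimes\eta_A);(A\otimes A\otimes\theta_{A^*}^{ -1});(A\otimes\sigma^{ -1}_{A^*,A});(\varphi\otimes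 A):A\to A\otimes A$. -}

module Defs where

open import Level using (Level; suc; _⊔_)
open import Relation.Binary using (IsEquivalence)

-- A ribbon category, stated non-strictly (with associator and unitors and
-- their coherence axioms); by Mac Lane coherence this is equivalent to the
-- strict presentation used in the paper. Composition f ⨾ g is diagrammatic.
record Ribbon (o ℓ e : Level) : Set (suc (o ⊔ ℓ ⊔ e)) where
  infixr 9 _⨾_
  infixr 10 _⊗₀_ _⊗₁_
  infix 4 _≈_
  field
    Obj  : Set o
    _⇒_  : Obj → Obj → Set ℓ
    _≈_  : ∀ {X Y} → X ⇒ Y → X ⇒ Y → Set e
    ≈-equiv : ∀ {X Y} → IsEquivalence (_≈_ {X} {Y})
    id   : ∀ {X} → X ⇒ X
    _⨾_  : ∀ {X Y Z} → X ⇒ Y → Y ⇒ Z → X ⇒ Z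
    identityˡ : ∀ {X Y} {f : X ⇒ Y} → id ⨾ f ≈ f
    identityʳ : ∀ {X Y} {f : X ⇒ Y} → f ⨾ id ≈ f
    assoc : ∀ {W X Y Z} {f : W ⇒ X} {g : X ⇒ Y} {h : Y ⇒ Z} →
            (f ⨾ g) ⨾ h ≈ f ⨾ (g ⨾ h)
    ⨾-resp-≈ : ∀ {X Y Z} {f f′ : X ⇒ Y} {g g′ : Y ⇒ Z} →
               f ≈ f′ → g ≈ g′ → f ⨾ g ≈ f′ ⨾ g′
    I    : Obj
    _⊗₀_ : Obj → Obj → Obj
    _⊗₁_ : ∀ {X Y X′ Y′} → X ⇒ X′ → Y ⇒ Y′ → (X ⊗₀ Y) ⇒ (X′ ⊗₀ Y′)
    ⊗-id : ∀ {X Y} → id {X} ⊗₁ id {Y} ≈ id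
    ⊗-⨾ : ∀ {X Y Z X′ Y′ Z′} {f : X ⇒ Y} {g : Y ⇒ Z} {h : X′ ⇒ Y′} {k : Y′ ⇒ Z′} →
          (f ⨾ g) ⊗₁ (h ⨾ k) ≈ (f ⊗₁ h) ⨾ (g ⊗₁ k)
    ⊗-resp-≈ : ∀ {X Y X′ Y′} {f f′ : X ⇒ X′} {g g′ : Y ⇒ Y′} →
               f ≈ f′ → g ≈ g′ → f ⊗₁ g ≈ f′ ⊗₁ g′
    α    : ∀ {X Y Z} → ((X ⊗₀ Y) ⊗₀ Z) ⇒ (X ⊗₀ (Y ⊗₀ Z))
    α⁻¹  : ∀ {X Y Z} → (X ⊗₀ (Y ⊗₀ Z)) ⇒ ((X ⊗₀ Y) ⊗₀ Z)
    α-isoˡ : ∀ {X Y Z} → α {X} {Y} {Z} ⨾ α⁻¹ ≈ id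
    α-isoʳ : ∀ {X Y Z} → α⁻¹ {X} {Y} {Z} ⨾ α ≈ id
    α-natural : ∀ {X Y Z X′ Y′ Z′} {f : X ⇒ X′} {g : Y ⇒ Y′} {h : Z ⇒ Z′} →
                ((f ⊗₁ g) ⊗₁ h) ⨾ α ≈ α ⨾ (f ⊗₁ (g ⊗₁ h))
    unitˡ   : ∀ {X} → (I ⊗₀ X) ⇒ X
    unitˡ⁻¹ : ∀ {X} → X ⇒ (I ⊗₀ X)
    unitˡ-isoˡ : ∀ {X} → unitˡ {X} ⨾ unitˡ⁻¹ ≈ id
    unitˡ-isoʳ : ∀ {X} → unitˡ⁻¹ {X} ⨾ unitˡ ≈ id
    unitˡ-natural : ∀ {X Y} {f : X ⇒ Y} → (id {I} ⊗₁ f) ⨾ unitˡ ≈ unitˡ ⨾ f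
    unitʳ   : ∀ {X} → (X ⊗₀ I) ⇒ X
    unitʳ⁻¹ : ∀ {X} → X ⇒ (X ⊗₀ I)
    unitʳ-isoˡ : ∀ {X} → unitʳ {X} ⨾ unitʳ⁻¹ ≈ id
    unitʳ-isoʳ : ∀ {X} → unitʳ⁻¹ {X} ⨾ unitʳ ≈ id
    unitʳ-natural : ∀ {X Y} {f : X ⇒ Y} → (f ⊗₁ id {I}) ⨾ unitʳ ≈ unitʳ ⨾ f
    pentagon : ∀ {W X Y Z} →
      (α {W} {X} {Y} ⊗₁ id {Z}) ⨾ α ⨾ (id ⊗₁ α) ≈ α ⨾ α
    triangle : ∀ {X Y} → α {X} {I} {Y} ⨾ (id ⊗₁ unitˡ) ≈ unitʳ ⊗₁ id
    σ   : ∀ {X Y} → (X ⊗₀ Y) ⇒ (Y ⊗₀ X)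
    σ⁻¹ : ∀ {X Y} → (Y ⊗₀ X) ⇒ (X ⊗₀ Y)
    σ-isoˡ : ∀ {X Y} → σ {X} {Y} ⨾ σ⁻¹ ≈ id
    σ-isoʳ : ∀ {X Y} → σ⁻¹ {X} {Y} ⨾ σ ≈ id
    σ-natural : ∀ {X Y X′ Y′} {f : X ⇒ X′} {g : Y ⇒ Y′} →
                (f ⊗₁ g) ⨾ σ ≈ σ ⨾ (g ⊗₁ f)
    hexagon₁ : ∀ {X Y Z} →
      σ {X} {Y ⊗₀ Z} ≈ α⁻¹ ⨾ (σ ⊗₁ id) ⨾ α ⨾ (id ⊗₁ σ) ⨾ α⁻¹
    hexagon₂ : ∀ {X Y Z} →
      σ {X ⊗₀ Y} {Z} ≈ α ⨾ (id ⊗₁ σ) ⨾ α⁻¹ ⨾ (σ ⊗₁ id) ⨾ α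
    θ   : ∀ {X} → X ⇒ X
    θ⁻¹ : ∀ {X} → X ⇒ X
    θ-isoˡ : ∀ {X} → θ {X} ⨾ θ⁻¹ ≈ id
    θ-isoʳ : ∀ {X} → θ⁻¹ {X} ⨾ θ ≈ id
    θ-natural : ∀ {X Y} {f : X ⇒ Y} → f ⨾ θ ≈ θ ⨾ f
    θ-⊗ : ∀ {X Y} → θ {X ⊗₀ Y} ≈ σ {X} {Y} ⨾ (θ {Y} ⊗₁ θ {X}) ⨾ σ {Y} {X}
    _*  : Obj → Obj
    η   : ∀ {X} → I ⇒ (X ⊗₀ (X *))
    ε   : ∀ {X} → ((X *) ⊗₀ X) ⇒ I
    snake₁ : ∀ {X} →
      unitˡ⁻¹ ⨾ (η ⊗₁ id) ⨾ α ⨾ (id ⊗₁ ε) ⨾ unitʳ ≈ id {X}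
    snake₂ : ∀ {X} →
      unitʳ⁻¹ ⨾ (id ⊗₁ η) ⨾ α⁻¹ ⨾ (ε ⊗₁ id) ⨾ unitˡ ≈ id {X *}

  dual : ∀ {X Y} → X ⇒ Y → (Y *) ⇒ (X *)
  dual {X} {Y} f =
    unitʳ⁻¹ ⨾ (id {Y *} ⊗₁ η {X}) ⨾ (id ⊗₁ (f ⊗₁ id)) ⨾ α⁻¹ ⨾ (ε {Y} ⊗₁ id) ⨾ unitˡ

  field
    θ-dual : ∀ {X} → dual (θ {X}) ≈ θ {X *}

  Tr : ∀ {X U V} → (U ⊗₀ X) ⇒ (V ⊗₀ X) → U ⇒ V
  Tr {X} {U} {V} g =
    unitʳ⁻¹ ⨾ (id {U} ⊗₁ η {X}) ⨾ α⁻¹ ⨾ (g ⊗₁ id) ⨾ α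
      ⨾ (id {V} ⊗₁ (σ {X} {X *} ⨾ (id ⊗₁ θ {X}) ⨾ ε {X})) ⨾ unitʳ

  TrL : ∀ {X B C} → (X ⊗₀ B) ⇒ (X ⊗₀ C) → B ⇒ C
  TrL {X} {B} {C} f = Tr {X} (σ⁻¹ {X} {B} ⨾ f ⨾ σ {X} {C})

record Reflexive {o ℓ e} (𝐂 : Ribbon o ℓ e) : Set (o ⊔ ℓ ⊔ e) where
  open Ribbon 𝐂
  field
    A    : Obj
    φ    : (A ⊗₀ (A *)) ⇒ A
    φ⁻¹  : A ⇒ (A ⊗₀ (A *))
    φ-isoˡ : φ ⨾ φ⁻¹ ≈ id
    φ-isoʳ : φ⁻¹ ⨾ φ ≈ id

  app : (A ⊗₀ A) ⇒ A
  app = (φ⁻¹ ⊗₁ id) ⨾ α ⨾ (id ⊗₁ ε) ⨾ unitʳ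

  lam : A ⇒ (A ⊗₀ A)
  lam = unitʳ⁻¹ ⨾ (id ⊗₁ η) ⨾ (id ⊗₁ (id ⊗₁ θ⁻¹ {A *}))
        ⨾ (id ⊗₁ σ⁻¹ {A *} {A}) ⨾ α⁻¹ ⨾ (φ ⊗₁ id)

module Submission where

open import Relation.Binary using (IsEquivalence; Setoid)
import Relation.Binary.Reasoning.Setoid as SetoidReasoning
open import Defs

-- Since φ is an isomorphism it cancels between lam and app, and what is left of
-- the left-hand side is A ⊗ (the contraction of f along the twisted cup
-- η ⨾ (id ⊗ θ⁻¹) ⨾ σ⁻¹ and the plain cap ε). In the left trace, the hexagon
-- axioms slide the cup and cap of Tr past the braidings σ⁻¹ and σ wrapped around
-- f; this leaves the double braiding σ ⨾ σ in front of the twisted cap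
-- σ ⨾ (id ⊗ θ) ⨾ ε, and since θ_{X* ⊗ X} = σ ⨾ (θ ⊗ θ) ⨾ σ commutes with ε and
-- θ_I = id, the double braiding turns that cap into (θ⁻¹ ⊗ id) ⨾ ε. The twist
-- θ⁻¹ then travels back to the cup.

module Reasoning {o ℓ e} (𝐂 : Ribbon o ℓ e) where
  open Ribbon 𝐂

  module HomEquivalence {X Y : Obj} = IsEquivalence (≈-equiv {X} {Y})
  open HomEquivalence public using (refl; sym; trans)

  hom-setoid : Obj → Obj → Setoid ℓ e
  hom-setoid X Y = record { isEquivalence = ≈-equiv {X} {Y} }

  module HomReasoning {X Y : Obj} = SetoidReasoning (hom-setoid X Y)
  open HomReasoning public using (begin_; _∎; step-≈-⟩; step-≈-⟨)

  infixr 8 refl⟩⨾⟨_ _⟩⨾⟨refl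
  refl⟩⨾⟨_ : ∀ {X Y Z} {f : X ⇒ Y} {g g′ : Y ⇒ Z} → g ≈ g′ → f ⨾ g ≈ f ⨾ g′
  refl⟩⨾⟨ p = ⨾-resp-≈ refl p

  _⟩⨾⟨refl : ∀ {X Y Z} {f f′ : X ⇒ Y} {g : Y ⇒ Z} → f ≈ f′ → f ⨾ g ≈ f′ ⨾ g
  p ⟩⨾⟨refl = ⨾-resp-≈ p refl

  pullˡ : ∀ {W X Y Z} {a : W ⇒ X} {b : X ⇒ Y} {c : W ⇒ Y} {r : Y ⇒ Z} →
          a ⨾ b ≈ c → a ⨾ b ⨾ r ≈ c ⨾ r
  pullˡ p = trans (sym assoc) (p ⟩⨾⟨refl)

  pullˡ₃ : ∀ {V W X Y Z} {a : V ⇒ W} {b : W ⇒ X} {c : X ⇒ Y} {d : V ⇒ Y} {r : Y ⇒ Z} →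
           a ⨾ b ⨾ c ≈ d → a ⨾ b ⨾ c ⨾ r ≈ d ⨾ r
  pullˡ₃ p = trans (refl⟩⨾⟨ sym assoc) (pullˡ p)

  pullˡ₄ : ∀ {U V W X Y Z} {a : U ⇒ V} {b : V ⇒ W} {c : W ⇒ X} {d : X ⇒ Y} {x : U ⇒ Y}
           {r : Y ⇒ Z} → a ⨾ b ⨾ c ⨾ d ≈ x → a ⨾ b ⨾ c ⨾ d ⨾ r ≈ x ⨾ r
  pullˡ₄ p = trans (refl⟩⨾⟨ refl⟩⨾⟨ sym assoc) (pullˡ₃ p)

  pullˡ₅ : ∀ {T U V W X Y Z} {a : T ⇒ U} {b : U ⇒ V} {c : V ⇒ W} {d : W ⇒ X} {e : X ⇒ Y}
           {x : T ⇒ Y} {r : Y ⇒ Z} → a ⨾ b ⨾ c ⨾ d ⨾ e ≈ x → a ⨾ b ⨾ c ⨾ d ⨾ e ⨾ r ≈ x ⨾ r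
  pullˡ₅ p = trans (refl⟩⨾⟨ refl⟩⨾⟨ refl⟩⨾⟨ sym assoc) (pullˡ₄ p)

  cancelˡ : ∀ {X Y Z} {a : X ⇒ Y} {b : Y ⇒ X} {r : X ⇒ Z} → a ⨾ b ≈ id → a ⨾ b ⨾ r ≈ r
  cancelˡ p = trans (pullˡ p) identityˡ

  cancelʳ : ∀ {X Y Z} {a : X ⇒ Y} {b : Y ⇒ Z} {c : Z ⇒ Y} → b ⨾ c ≈ id → (a ⨾ b) ⨾ c ≈ a
  cancelʳ p = trans assoc (trans (refl⟩⨾⟨ p) identityʳ)

  split-mono-cancel : ∀ {X Y Z} {i : X ⇒ Y} {i′ : Y ⇒ X} {a b : Y ⇒ Z} →
                      i′ ⨾ i ≈ id → i ⨾ a ≈ i ⨾ b → a ≈ b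
  split-mono-cancel q p = trans (sym (cancelˡ q)) (trans (refl⟩⨾⟨ p) (cancelˡ q))

  split-epi-cancel : ∀ {X Y Z} {i : Y ⇒ Z} {i′ : Z ⇒ Y} {a b : X ⇒ Y} →
                     i ⨾ i′ ≈ id → a ⨾ i ≈ b ⨾ i → a ≈ b
  split-epi-cancel q p = trans (sym (cancelʳ q)) (trans (p ⟩⨾⟨refl) (cancelʳ q))

  conjugate : ∀ {X Y X′ Y′} {a : X ⇒ X′} {j : X′ ⇒ Y′} {i : X ⇒ Y} {b : Y ⇒ Y′}
              {i′ : Y ⇒ X} {j′ : Y′ ⇒ X′} →
              i′ ⨾ i ≈ id → j ⨾ j′ ≈ id → a ⨾ j ≈ i ⨾ b → i′ ⨾ a ≈ b ⨾ j′
  conjugate {a = a} {j} {i} {b} {i′} {j′} i′i≈id jj′≈id square = begin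
    i′ ⨾ a
      ≈⟨ refl⟩⨾⟨ cancelʳ jj′≈id ⟨
    i′ ⨾ (a ⨾ j) ⨾ j′
      ≈⟨ refl⟩⨾⟨ (square ⟩⨾⟨refl) ⟩
    i′ ⨾ (i ⨾ b) ⨾ j′
      ≈⟨ refl⟩⨾⟨ assoc ⟩
    i′ ⨾ i ⨾ b ⨾ j′
      ≈⟨ cancelˡ i′i≈id ⟩
    b ⨾ j′ ∎

  ⊗id-distrib : ∀ {X Y Z W} {f : X ⇒ Y} {g : Y ⇒ Z} →
                (f ⨾ g) ⊗₁ id {W} ≈ (f ⊗₁ id) ⨾ (g ⊗₁ id)
  ⊗id-distrib = trans (⊗-resp-≈ refl (sym identityˡ)) ⊗-⨾

  id⊗-distrib : ∀ {X Y Z W} {f : X ⇒ Y} {g : Y ⇒ Z} →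
                id {W} ⊗₁ (f ⨾ g) ≈ (id ⊗₁ f) ⨾ (id ⊗₁ g)
  id⊗-distrib = trans (⊗-resp-≈ (sym identityˡ) refl) ⊗-⨾

  ⊗-exchange : ∀ {X Y X′ Y′} {f : X ⇒ X′} {g : Y ⇒ Y′} →
               (f ⊗₁ id) ⨾ (id ⊗₁ g) ≈ (id ⊗₁ g) ⨾ (f ⊗₁ id)
  ⊗-exchange = trans (sym ⊗-⨾)
    (trans (⊗-resp-≈ (trans identityʳ (sym identityˡ)) (trans identityˡ (sym identityʳ))) ⊗-⨾)

  ⊗id-inverse : ∀ {X Y W} {f : X ⇒ Y} {g : Y ⇒ X} → f ⨾ g ≈ id → (f ⊗₁ id {W}) ⨾ (g ⊗₁ id) ≈ id
  ⊗id-inverse p = trans (sym ⊗id-distrib) (trans (⊗-resp-≈ p refl) ⊗-id)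

  id⊗-inverse : ∀ {X Y W} {f : X ⇒ Y} {g : Y ⇒ X} → f ⨾ g ≈ id → (id {W} ⊗₁ f) ⨾ (id ⊗₁ g) ≈ id
  id⊗-inverse p = trans (sym id⊗-distrib) (trans (⊗-resp-≈ refl p) ⊗-id)

module Coherence {o ℓ e} (𝐂 : Ribbon o ℓ e) where
  open Ribbon 𝐂
  open Reasoning 𝐂

  α⁻¹-natural : ∀ {X Y Z X′ Y′ Z′} {f : X ⇒ X′} {g : Y ⇒ Y′} {h : Z ⇒ Z′} →
                (f ⊗₁ (g ⊗₁ h)) ⨾ α⁻¹ ≈ α⁻¹ ⨾ ((f ⊗₁ g) ⊗₁ h)
  α⁻¹-natural = sym (conjugate α-isoʳ α-isoˡ α-natural)

  σ⁻¹-natural : ∀ {X Y X′ Y′} {f : X ⇒ X′} {g : Y ⇒ Y′} →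
                (g ⊗₁ f) ⨾ σ⁻¹ ≈ σ⁻¹ ⨾ (f ⊗₁ g)
  σ⁻¹-natural = sym (conjugate σ-isoʳ σ-isoˡ σ-natural)

  ⊗I-injective : ∀ {X Y} {f g : X ⇒ Y} → f ⊗₁ id {I} ≈ g ⊗₁ id → f ≈ g
  ⊗I-injective p = split-mono-cancel {i = unitʳ} unitʳ-isoʳ
    (trans (sym unitʳ-natural) (trans (p ⟩⨾⟨refl) unitʳ-natural))

  I⊗-injective : ∀ {X Y} {f g : X ⇒ Y} → id {I} ⊗₁ f ≈ id ⊗₁ g → f ≈ g
  I⊗-injective p = split-mono-cancel {i = unitˡ} unitˡ-isoʳ
    (trans (sym unitˡ-natural) (trans (p ⟩⨾⟨refl) unitˡ-natural))

  triangle⁻¹ : ∀ {X Y} → (unitʳ⁻¹ ⊗₁ id) ⨾ α {X} {I} {Y} ≈ id ⊗₁ unitˡ⁻¹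
  triangle⁻¹ = trans (conjugate (⊗id-inverse unitʳ-isoʳ) (id⊗-inverse unitˡ-isoˡ)
                                (trans triangle (sym identityʳ)))
                     identityˡ

  triangle-α⁻¹ : ∀ {X Y} → α⁻¹ {X} {I} {Y} ⨾ (unitʳ ⊗₁ id) ≈ id ⊗₁ unitˡ
  triangle-α⁻¹ = trans (refl⟩⨾⟨ sym triangle) (cancelˡ α-isoʳ)

  -- Kelly's lemma: after whiskering with I it follows from the pentagon and the triangle.
  α-unitʳ : ∀ {X Y} → α {X} {Y} {I} ⨾ (id ⊗₁ unitʳ) ≈ unitʳ
  α-unitʳ {X} {Y} = ⊗I-injective (trans ⊗id-distrib (split-epi-cancel α-isoˡ (trans assoc whiskered)))
    where
    whiskered : (α ⊗₁ id) ⨾ ((id ⊗₁ unitʳ) ⊗₁ id) ⨾ α {X} {Y} {I} ≈ (unitʳ ⊗₁ id) ⨾ α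
    whiskered = begin
      (α ⊗₁ id) ⨾ ((id ⊗₁ unitʳ) ⊗₁ id) ⨾ α
        ≈⟨ refl⟩⨾⟨ α-natural ⟩
      (α ⊗₁ id) ⨾ α ⨾ (id ⊗₁ (unitʳ ⊗₁ id))
        ≈⟨ refl⟩⨾⟨ refl⟩⨾⟨ ⊗-resp-≈ refl (sym triangle) ⟩
      (α ⊗₁ id) ⨾ α ⨾ (id ⊗₁ (α ⨾ (id ⊗₁ unitˡ)))
        ≈⟨ refl⟩⨾⟨ refl⟩⨾⟨ id⊗-distrib ⟩
      (α ⊗₁ id) ⨾ α ⨾ (id ⊗₁ α) ⨾ (id ⊗₁ (id ⊗₁ unitˡ)) ≈⟨ pullˡ₃ pentagon ⟩
      (α ⨾ α) ⨾ (id ⊗₁ (id ⊗₁ unitˡ))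
        ≈⟨ assoc ⟩
      α ⨾ α ⨾ (id ⊗₁ (id ⊗₁ unitˡ))
        ≈⟨ refl⟩⨾⟨ sym α-natural ⟩
      α ⨾ ((id ⊗₁ id) ⊗₁ unitˡ) ⨾ α
        ≈⟨ refl⟩⨾⟨ (⊗-resp-≈ ⊗-id refl ⟩⨾⟨refl) ⟩
      α ⨾ (id ⊗₁ unitˡ) ⨾ α
        ≈⟨ pullˡ triangle ⟩
      (unitʳ ⊗₁ id) ⨾ α ∎

  α⁻¹-unitʳ : ∀ {X Y} → α⁻¹ {X} {Y} {I} ⨾ unitʳ ≈ id ⊗₁ unitʳ
  α⁻¹-unitʳ = trans (refl⟩⨾⟨ sym α-unitʳ) (cancelˡ α-isoʳ)

  unitˡ≈unitʳ : unitˡ {I} ≈ unitʳ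
  unitˡ≈unitʳ = sym (I⊗-injective (split-mono-cancel {i = α} α-isoʳ
                  (trans α-unitʳ (trans unitʳ-I⊗I (sym triangle)))))
    where
    unitʳ-I⊗I : unitʳ {I ⊗₀ I} ≈ unitʳ ⊗₁ id
    unitʳ-I⊗I = split-epi-cancel unitʳ-isoˡ (sym unitʳ-natural)

  hexagon₂-α⁻¹ : ∀ {P Q R} →
                 α ⨾ (id ⊗₁ σ {Q} {R}) ⨾ α⁻¹ ≈ σ {P ⊗₀ Q} {R} ⨾ α⁻¹ ⨾ (σ⁻¹ ⊗₁ id)
  hexagon₂-α⁻¹ = sym (begin
    σ ⨾ α⁻¹ ⨾ (σ⁻¹ ⊗₁ id)
      ≈⟨ hexagon₂ ⟩⨾⟨refl ⟩
    (α ⨾ (id ⊗₁ σ) ⨾ α⁻¹ ⨾ (σ ⊗₁ id) ⨾ α) ⨾ α⁻¹ ⨾ (σ⁻¹ ⊗₁ id)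
      ≈⟨ sym (pullˡ₅ refl) ⟩
    α ⨾ (id ⊗₁ σ) ⨾ α⁻¹ ⨾ (σ ⊗₁ id) ⨾ α ⨾ α⁻¹ ⨾ (σ⁻¹ ⊗₁ id)
      ≈⟨ refl⟩⨾⟨ refl⟩⨾⟨ refl⟩⨾⟨ refl⟩⨾⟨ cancelˡ α-isoˡ ⟩
    α ⨾ (id ⊗₁ σ) ⨾ α⁻¹ ⨾ (σ ⊗₁ id) ⨾ (σ⁻¹ ⊗₁ id)
      ≈⟨ refl⟩⨾⟨ refl⟩⨾⟨ refl⟩⨾⟨ ⊗id-inverse σ-isoˡ ⟩
    α ⨾ (id ⊗₁ σ) ⨾ α⁻¹ ⨾ id
      ≈⟨ refl⟩⨾⟨ refl⟩⨾⟨ identityʳ ⟩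
    α ⨾ (id ⊗₁ σ) ⨾ α⁻¹ ∎)

  -- Obtained by comparing the hexagon for σ_{I ⊗ I, Z} with the triangle axiom.
  σ-unitʳ : ∀ {Z} → σ {I} {Z} ⨾ unitʳ ≈ unitˡ
  σ-unitʳ {Z} = sym (I⊗-injective (split-mono-cancel {i = α} α-isoʳ
                  (trans triangle (split-epi-cancel σ-isoˡ braided-triangle))))
    where
    braided-triangle : (unitʳ ⊗₁ id) ⨾ σ {I} {Z} ≈ (α ⨾ (id ⊗₁ (σ ⨾ unitʳ))) ⨾ σ
    braided-triangle = begin
      (unitʳ ⊗₁ id) ⨾ σ
        ≈⟨ σ-natural ⟩
      σ ⨾ (id ⊗₁ unitʳ)
        ≈⟨ hexagon₂ ⟩⨾⟨refl ⟩
      (α ⨾ (id ⊗₁ σ) ⨾ α⁻¹ ⨾ (σ ⊗₁ id) ⨾ α) ⨾ (id ⊗₁ unitʳ)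
        ≈⟨ sym (pullˡ₅ refl) ⟩
      α ⨾ (id ⊗₁ σ) ⨾ α⁻¹ ⨾ (σ ⊗₁ id) ⨾ α ⨾ (id ⊗₁ unitʳ)
        ≈⟨ refl⟩⨾⟨ refl⟩⨾⟨ refl⟩⨾⟨ refl⟩⨾⟨ α-unitʳ ⟩
      α ⨾ (id ⊗₁ σ) ⨾ α⁻¹ ⨾ (σ ⊗₁ id) ⨾ unitʳ
        ≈⟨ refl⟩⨾⟨ refl⟩⨾⟨ refl⟩⨾⟨ unitʳ-natural ⟩
      α ⨾ (id ⊗₁ σ) ⨾ α⁻¹ ⨾ unitʳ ⨾ σ
        ≈⟨ refl⟩⨾⟨ refl⟩⨾⟨ pullˡ α⁻¹-unitʳ ⟩
      α ⨾ (id ⊗₁ σ) ⨾ (id ⊗₁ unitʳ) ⨾ σ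
        ≈⟨ refl⟩⨾⟨ pullˡ (sym id⊗-distrib) ⟩
      α ⨾ (id ⊗₁ (σ ⨾ unitʳ)) ⨾ σ
        ≈⟨ sym assoc ⟩
      (α ⨾ (id ⊗₁ (σ ⨾ unitʳ))) ⨾ σ ∎

  unitˡ⁻¹-σ : ∀ {Z} → unitˡ⁻¹ ⨾ σ {I} {Z} ≈ unitʳ⁻¹
  unitˡ⁻¹-σ = trans (conjugate unitˡ-isoʳ unitʳ-isoˡ (trans σ-unitʳ (sym identityʳ))) identityˡ

  σ-I : σ {I} {I} ≈ id
  σ-I = split-epi-cancel unitʳ-isoˡ (trans σ-unitʳ (trans unitˡ≈unitʳ (sym identityˡ)))

  pentagon-α⁻¹⊗id : ∀ {W X Y Z} → (α⁻¹ {W} {X} {Y} ⊗₁ id {Z}) ⨾ α ≈ α ⨾ (id ⊗₁ α) ⨾ α⁻¹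
  pentagon-α⁻¹⊗id = trans (conjugate (⊗id-inverse α-isoʳ) α-isoˡ (sym pentagon)) assoc

  pentagon-α⁻¹α⁻¹ : ∀ {W X Y Z} → α⁻¹ ⨾ α⁻¹ ⨾ (α {W} {X} {Y} ⊗₁ id {Z}) ≈ (id ⊗₁ α⁻¹) ⨾ α⁻¹
  pentagon-α⁻¹α⁻¹ = conjugate α-isoʳ α-isoˡ (begin
    (α⁻¹ ⨾ (α ⊗₁ id)) ⨾ α
      ≈⟨ assoc ⟩
    α⁻¹ ⨾ (α ⊗₁ id) ⨾ α
      ≈⟨ refl⟩⨾⟨ sym (cancelʳ (id⊗-inverse α-isoˡ)) ⟩
    α⁻¹ ⨾ (((α ⊗₁ id) ⨾ α) ⨾ (id ⊗₁ α)) ⨾ (id ⊗₁ α⁻¹)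
      ≈⟨ refl⟩⨾⟨ (trans assoc pentagon ⟩⨾⟨refl) ⟩
    α⁻¹ ⨾ (α ⨾ α) ⨾ (id ⊗₁ α⁻¹)
      ≈⟨ refl⟩⨾⟨ assoc ⟩
    α⁻¹ ⨾ α ⨾ α ⨾ (id ⊗₁ α⁻¹)
      ≈⟨ cancelˡ α-isoʳ ⟩
    α ⨾ (id ⊗₁ α⁻¹) ∎)

  α-whisker-natural : ∀ {P Q X B C} {u : P ⇒ Q} {f : (X ⊗₀ B) ⇒ (X ⊗₀ C)} →
    ((u ⊗₁ id) ⊗₁ id) ⨾ α ⨾ (id ⊗₁ f) ⨾ α⁻¹ ≈ α ⨾ (id ⊗₁ f) ⨾ α⁻¹ ⨾ ((u ⊗₁ id) ⊗₁ id)
  α-whisker-natural {u = u} {f} = begin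
    ((u ⊗₁ id) ⊗₁ id) ⨾ α ⨾ (id ⊗₁ f) ⨾ α⁻¹
      ≈⟨ pullˡ (trans α-natural (refl⟩⨾⟨ ⊗-resp-≈ refl ⊗-id)) ⟩
    (α ⨾ (u ⊗₁ id)) ⨾ (id ⊗₁ f) ⨾ α⁻¹
      ≈⟨ assoc ⟩
    α ⨾ (u ⊗₁ id) ⨾ (id ⊗₁ f) ⨾ α⁻¹
      ≈⟨ refl⟩⨾⟨ trans (pullˡ ⊗-exchange) assoc ⟩
    α ⨾ (id ⊗₁ f) ⨾ (u ⊗₁ id) ⨾ α⁻¹
      ≈⟨ refl⟩⨾⟨ refl⟩⨾⟨ (⊗-resp-≈ refl (sym ⊗-id) ⟩⨾⟨refl) ⟩
    α ⨾ (id ⊗₁ f) ⨾ (u ⊗₁ (id ⊗₁ id)) ⨾ α⁻¹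
      ≈⟨ refl⟩⨾⟨ refl⟩⨾⟨ α⁻¹-natural ⟩
    α ⨾ (id ⊗₁ f) ⨾ α⁻¹ ⨾ ((u ⊗₁ id) ⊗₁ id) ∎

module Twist {o ℓ e} (𝐂 : Ribbon o ℓ e) where
  open Ribbon 𝐂
  open Reasoning 𝐂
  open Coherence 𝐂

  -- As σ_{I,I} = id, θ-⊗ at I ⊗ I makes θ_I ⊗ θ_I equal to θ_I up to unitors: θ_I is idempotent.
  θ-I : θ {I} ≈ id
  θ-I = sym (split-mono-cancel {i = θ} θ-isoʳ
              (trans identityʳ (split-mono-cancel {i = unitʳ} unitʳ-isoʳ idempotent)))
    where
    idempotent : unitʳ ⨾ θ ≈ unitʳ ⨾ θ ⨾ θ
    idempotent = begin
      unitʳ ⨾ θ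
        ≈⟨ θ-natural ⟩
      θ ⨾ unitʳ
        ≈⟨ θ-⊗ ⟩⨾⟨refl ⟩
      (σ ⨾ (θ ⊗₁ θ) ⨾ σ) ⨾ unitʳ
        ≈⟨ ⨾-resp-≈ σ-I (refl⟩⨾⟨ σ-I) ⟩⨾⟨refl ⟩
      (id ⨾ (θ ⊗₁ θ) ⨾ id) ⨾ unitʳ
        ≈⟨ trans identityˡ identityʳ ⟩⨾⟨refl ⟩
      (θ ⊗₁ θ) ⨾ unitʳ
        ≈⟨ ⊗-resp-≈ (sym identityʳ) (sym identityˡ) ⟩⨾⟨refl ⟩
      ((θ ⨾ id) ⊗₁ (id ⨾ θ)) ⨾ unitʳ
        ≈⟨ trans (⊗-⨾ ⟩⨾⟨refl) assoc ⟩
      (θ ⊗₁ id) ⨾ (id ⊗₁ θ) ⨾ unitʳ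
        ≈⟨ refl⟩⨾⟨ refl⟩⨾⟨ sym unitˡ≈unitʳ ⟩
      (θ ⊗₁ id) ⨾ (id ⊗₁ θ) ⨾ unitˡ
        ≈⟨ refl⟩⨾⟨ unitˡ-natural ⟩
      (θ ⊗₁ id) ⨾ unitˡ ⨾ θ
        ≈⟨ refl⟩⨾⟨ (unitˡ≈unitʳ ⟩⨾⟨refl) ⟩
      (θ ⊗₁ id) ⨾ unitʳ ⨾ θ
        ≈⟨ trans (pullˡ unitʳ-natural) assoc ⟩
      unitʳ ⨾ θ ⨾ θ ∎

  monodromy-ε : ∀ {X} → σ {X *} {X} ⨾ σ {X} {X *} ⨾ (id ⊗₁ θ) ⨾ ε ≈ (θ⁻¹ ⊗₁ id) ⨾ ε
  monodromy-ε {X} = begin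
    σ ⨾ σ ⨾ (id ⊗₁ θ) ⨾ ε
      ≈⟨ cancelˡ (⊗id-inverse θ-isoʳ) ⟨
    (θ⁻¹ ⊗₁ id) ⨾ (θ ⊗₁ id) ⨾ σ ⨾ σ ⨾ (id ⊗₁ θ) ⨾ ε
      ≈⟨ refl⟩⨾⟨ twisted ⟩
    (θ⁻¹ ⊗₁ id) ⨾ ε ∎
    where
    twisted : (θ ⊗₁ id) ⨾ σ {X *} {X} ⨾ σ ⨾ (id ⊗₁ θ) ⨾ ε ≈ ε
    twisted = begin
      (θ ⊗₁ id) ⨾ σ ⨾ σ ⨾ (id ⊗₁ θ) ⨾ ε
        ≈⟨ trans (pullˡ σ-natural) assoc ⟩
      σ ⨾ (id ⊗₁ θ) ⨾ σ ⨾ (id ⊗₁ θ) ⨾ ε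
        ≈⟨ refl⟩⨾⟨ trans (pullˡ σ-natural) assoc ⟩
      σ ⨾ σ ⨾ (θ ⊗₁ id) ⨾ (id ⊗₁ θ) ⨾ ε
        ≈⟨ refl⟩⨾⟨ refl⟩⨾⟨ pullˡ (sym ⊗-⨾) ⟩
      σ ⨾ σ ⨾ ((θ ⨾ id) ⊗₁ (id ⨾ θ)) ⨾ ε
        ≈⟨ refl⟩⨾⟨ refl⟩⨾⟨ (⊗-resp-≈ identityʳ identityˡ ⟩⨾⟨refl) ⟩
      σ ⨾ σ ⨾ (θ ⊗₁ θ) ⨾ ε
        ≈⟨ refl⟩⨾⟨ pullˡ (sym σ-natural) ⟩
      σ ⨾ ((θ ⊗₁ θ) ⨾ σ) ⨾ ε
        ≈⟨ pullˡ (sym θ-⊗) ⟩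
      θ ⨾ ε
        ≈⟨ θ-natural ⟨
      ε ⨾ θ
        ≈⟨ refl⟩⨾⟨ θ-I ⟩
      ε ⨾ id
        ≈⟨ identityʳ ⟩
      ε ∎

module Contraction {o ℓ e} (𝐂 : Ribbon o ℓ e) where
  open Ribbon 𝐂
  open Reasoning 𝐂
  open Coherence 𝐂
  open Twist 𝐂

  twisted-η : ∀ {X} → I ⇒ ((X *) ⊗₀ X)
  twisted-η = η ⨾ (id ⊗₁ θ⁻¹) ⨾ σ⁻¹

  contract : ∀ {X B C} → (X ⊗₀ B) ⇒ (X ⊗₀ C) → B ⇒ C
  contract f = unitˡ⁻¹ ⨾ (twisted-η ⊗₁ id) ⨾ α ⨾ (id ⊗₁ f) ⨾ α⁻¹ ⨾ (ε ⊗₁ id) ⨾ unitˡ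

  cup-slide : ∀ {X Y B} {d : I ⇒ (X ⊗₀ Y)} →
    unitʳ⁻¹ ⨾ (id {B} ⊗₁ d) ⨾ α⁻¹ ⨾ (σ⁻¹ {X} {B} ⊗₁ id)
      ≈ unitˡ⁻¹ ⨾ ((d ⨾ σ⁻¹) ⊗₁ id) ⨾ α ⨾ σ {Y} {X ⊗₀ B}
  cup-slide {d = d} = sym (begin
    unitˡ⁻¹ ⨾ ((d ⨾ σ⁻¹) ⊗₁ id) ⨾ α ⨾ σ
      ≈⟨ refl⟩⨾⟨ refl⟩⨾⟨ refl⟩⨾⟨ hexagon₁ ⟩
    unitˡ⁻¹ ⨾ ((d ⨾ σ⁻¹) ⊗₁ id) ⨾ α ⨾ α⁻¹ ⨾ (σ ⊗₁ id) ⨾ α ⨾ (id ⊗₁ σ) ⨾ α⁻¹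
      ≈⟨ refl⟩⨾⟨ refl⟩⨾⟨ cancelˡ α-isoˡ ⟩
    unitˡ⁻¹ ⨾ ((d ⨾ σ⁻¹) ⊗₁ id) ⨾ (σ ⊗₁ id) ⨾ α ⨾ (id ⊗₁ σ) ⨾ α⁻¹
      ≈⟨ refl⟩⨾⟨ pullˡ (trans (sym ⊗id-distrib) (⊗-resp-≈ (cancelʳ σ-isoʳ) refl)) ⟩
    unitˡ⁻¹ ⨾ (d ⊗₁ id) ⨾ α ⨾ (id ⊗₁ σ) ⨾ α⁻¹
      ≈⟨ refl⟩⨾⟨ refl⟩⨾⟨ hexagon₂-α⁻¹ ⟩
    unitˡ⁻¹ ⨾ (d ⊗₁ id) ⨾ σ ⨾ α⁻¹ ⨾ (σ⁻¹ ⊗₁ id)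
      ≈⟨ refl⟩⨾⟨ trans (pullˡ σ-natural) assoc ⟩
    unitˡ⁻¹ ⨾ σ ⨾ (id ⊗₁ d) ⨾ α⁻¹ ⨾ (σ⁻¹ ⊗₁ id)
      ≈⟨ pullˡ unitˡ⁻¹-σ ⟩
    unitʳ⁻¹ ⨾ (id ⊗₁ d) ⨾ α⁻¹ ⨾ (σ⁻¹ ⊗₁ id) ∎)

  cap-slide : ∀ {X Y C} {c : (X ⊗₀ Y) ⇒ I} →
    σ {Y} {X ⊗₀ C} ⨾ (σ {X} {C} ⊗₁ id) ⨾ α ⨾ (id ⊗₁ c) ⨾ unitʳ
      ≈ α⁻¹ ⨾ ((σ ⨾ c) ⊗₁ id) ⨾ unitˡ
  cap-slide {c = c} = begin
    σ ⨾ (σ ⊗₁ id) ⨾ α ⨾ (id ⊗₁ c) ⨾ unitʳ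
      ≈⟨ hexagon₁ ⟩⨾⟨refl ⟩
    (α⁻¹ ⨾ (σ ⊗₁ id) ⨾ α ⨾ (id ⊗₁ σ) ⨾ α⁻¹) ⨾ (σ ⊗₁ id) ⨾ α ⨾ (id ⊗₁ c) ⨾ unitʳ
      ≈⟨ sym (pullˡ₅ refl) ⟩
    α⁻¹ ⨾ (σ ⊗₁ id) ⨾ α ⨾ (id ⊗₁ σ) ⨾ α⁻¹ ⨾ (σ ⊗₁ id) ⨾ α ⨾ (id ⊗₁ c) ⨾ unitʳ
      ≈⟨ refl⟩⨾⟨ refl⟩⨾⟨ pullˡ₅ (sym hexagon₂) ⟩
    α⁻¹ ⨾ (σ ⊗₁ id) ⨾ σ ⨾ (id ⊗₁ c) ⨾ unitʳ
      ≈⟨ refl⟩⨾⟨ refl⟩⨾⟨ trans (pullˡ (sym σ-natural)) assoc ⟩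
    α⁻¹ ⨾ (σ ⊗₁ id) ⨾ (c ⊗₁ id) ⨾ σ ⨾ unitʳ
      ≈⟨ refl⟩⨾⟨ refl⟩⨾⟨ refl⟩⨾⟨ σ-unitʳ ⟩
    α⁻¹ ⨾ (σ ⊗₁ id) ⨾ (c ⊗₁ id) ⨾ unitˡ
      ≈⟨ refl⟩⨾⟨ pullˡ (sym ⊗id-distrib) ⟩
    α⁻¹ ⨾ ((σ ⨾ c) ⊗₁ id) ⨾ unitˡ ∎

  TrL≈contract : ∀ {X B C} (f : (X ⊗₀ B) ⇒ (X ⊗₀ C)) → TrL f ≈ contract f
  TrL≈contract {X} {B} {C} f = begin
    unitʳ⁻¹ ⨾ (id ⊗₁ η) ⨾ α⁻¹ ⨾ ((σ⁻¹ ⨾ f ⨾ σ) ⊗₁ id) ⨾ α ⨾ (id ⊗₁ cap) ⨾ unitʳ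
      ≈⟨ refl⟩⨾⟨ refl⟩⨾⟨ refl⟩⨾⟨ split-σ⁻¹⨾f⨾σ ⟩
    unitʳ⁻¹ ⨾ (id ⊗₁ η) ⨾ α⁻¹ ⨾ (σ⁻¹ ⊗₁ id)
      ⨾ (f ⊗₁ id) ⨾ (σ ⊗₁ id) ⨾ α ⨾ (id ⊗₁ cap) ⨾ unitʳ
      ≈⟨ trans (pullˡ₄ cup-slide) (sym (pullˡ₄ refl)) ⟩
    unitˡ⁻¹ ⨾ ((η ⨾ σ⁻¹) ⊗₁ id) ⨾ α ⨾ σ
      ⨾ (f ⊗₁ id) ⨾ (σ ⊗₁ id) ⨾ α ⨾ (id ⊗₁ cap) ⨾ unitʳ
      ≈⟨ refl⟩⨾⟨ refl⟩⨾⟨ refl⟩⨾⟨ trans (pullˡ (sym σ-natural)) assoc ⟩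
    unitˡ⁻¹ ⨾ ((η ⨾ σ⁻¹) ⊗₁ id) ⨾ α ⨾ (id ⊗₁ f)
      ⨾ σ ⨾ (σ ⊗₁ id) ⨾ α ⨾ (id ⊗₁ cap) ⨾ unitʳ
      ≈⟨ refl⟩⨾⟨ refl⟩⨾⟨ refl⟩⨾⟨ refl⟩⨾⟨ cap-slide ⟩
    unitˡ⁻¹ ⨾ ((η ⨾ σ⁻¹) ⊗₁ id) ⨾ α ⨾ (id ⊗₁ f) ⨾ α⁻¹ ⨾ ((σ ⨾ cap) ⊗₁ id) ⨾ unitˡ
      ≈⟨ refl⟩⨾⟨ refl⟩⨾⟨ refl⟩⨾⟨ refl⟩⨾⟨ refl⟩⨾⟨ (⊗-resp-≈ monodromy-ε refl ⟩⨾⟨refl) ⟩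
    unitˡ⁻¹ ⨾ ((η ⨾ σ⁻¹) ⊗₁ id) ⨾ α ⨾ (id ⊗₁ f) ⨾ α⁻¹ ⨾ (((θ⁻¹ ⊗₁ id) ⨾ ε) ⊗₁ id) ⨾ unitˡ
      ≈⟨ refl⟩⨾⟨ refl⟩⨾⟨ refl⟩⨾⟨ refl⟩⨾⟨ θ⁻¹-before-α⁻¹ ⟩
    unitˡ⁻¹ ⨾ ((η ⨾ σ⁻¹) ⊗₁ id) ⨾ α ⨾ (id ⊗₁ f) ⨾ (θ⁻¹ ⊗₁ id) ⨾ α⁻¹ ⨾ (ε ⊗₁ id) ⨾ unitˡ
      ≈⟨ refl⟩⨾⟨ refl⟩⨾⟨ refl⟩⨾⟨ trans (pullˡ (sym ⊗-exchange)) assoc ⟩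
    unitˡ⁻¹ ⨾ ((η ⨾ σ⁻¹) ⊗₁ id) ⨾ α ⨾ (θ⁻¹ ⊗₁ id) ⨾ (id ⊗₁ f) ⨾ α⁻¹ ⨾ (ε ⊗₁ id) ⨾ unitˡ
      ≈⟨ refl⟩⨾⟨ refl⟩⨾⟨ trans (pullˡ θ⁻¹-before-α) assoc ⟩
    unitˡ⁻¹ ⨾ ((η ⨾ σ⁻¹) ⊗₁ id) ⨾ ((θ⁻¹ ⊗₁ id) ⊗₁ id)
      ⨾ α ⨾ (id ⊗₁ f) ⨾ α⁻¹ ⨾ (ε ⊗₁ id) ⨾ unitˡ
      ≈⟨ refl⟩⨾⟨ pullˡ (trans (sym ⊗id-distrib) (⊗-resp-≈ η⨾σ⁻¹⨾θ⁻¹ refl)) ⟩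
    unitˡ⁻¹ ⨾ (twisted-η ⊗₁ id) ⨾ α ⨾ (id ⊗₁ f) ⨾ α⁻¹ ⨾ (ε ⊗₁ id) ⨾ unitˡ
      ∎
    where
    cap : (X ⊗₀ (X *)) ⇒ I
    cap = σ ⨾ (id ⊗₁ θ) ⨾ ε

    θ⁻¹-before-α⁻¹ : α⁻¹ ⨾ (((θ⁻¹ ⊗₁ id) ⨾ ε) ⊗₁ id) ⨾ unitˡ
                       ≈ (θ⁻¹ ⊗₁ id) ⨾ α⁻¹ ⨾ (ε ⊗₁ id) ⨾ unitˡ {C}
    θ⁻¹-before-α⁻¹ = begin
      α⁻¹ ⨾ (((θ⁻¹ ⊗₁ id) ⨾ ε) ⊗₁ id) ⨾ unitˡ
        ≈⟨ refl⟩⨾⟨ trans (⊗id-distrib ⟩⨾⟨refl) assoc ⟩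
      α⁻¹ ⨾ ((θ⁻¹ ⊗₁ id) ⊗₁ id) ⨾ (ε ⊗₁ id) ⨾ unitˡ
        ≈⟨ pullˡ (sym α⁻¹-natural) ⟩
      ((θ⁻¹ ⊗₁ (id ⊗₁ id)) ⨾ α⁻¹) ⨾ (ε ⊗₁ id) ⨾ unitˡ
        ≈⟨ trans assoc (⊗-resp-≈ refl ⊗-id ⟩⨾⟨refl) ⟩
      (θ⁻¹ ⊗₁ id) ⨾ α⁻¹ ⨾ (ε ⊗₁ id) ⨾ unitˡ ∎

    split-σ⁻¹⨾f⨾σ : ∀ {r : ((C ⊗₀ X) ⊗₀ (X *)) ⇒ C} →
      ((σ⁻¹ ⨾ f ⨾ σ) ⊗₁ id) ⨾ r ≈ (σ⁻¹ ⊗₁ id) ⨾ (f ⊗₁ id) ⨾ (σ ⊗₁ id) ⨾ r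
    split-σ⁻¹⨾f⨾σ = trans (trans ⊗id-distrib (refl⟩⨾⟨ ⊗id-distrib) ⟩⨾⟨refl) (trans assoc (refl⟩⨾⟨ assoc))

    θ⁻¹-before-α : α ⨾ (θ⁻¹ ⊗₁ id {X ⊗₀ B}) ≈ ((θ⁻¹ ⊗₁ id) ⊗₁ id) ⨾ α
    θ⁻¹-before-α = trans (refl⟩⨾⟨ ⊗-resp-≈ refl (sym ⊗-id)) (sym α-natural)

    η⨾σ⁻¹⨾θ⁻¹ : (η ⨾ σ⁻¹) ⨾ (θ⁻¹ ⊗₁ id) ≈ twisted-η
    η⨾σ⁻¹⨾θ⁻¹ = trans assoc (refl⟩⨾⟨ sym σ⁻¹-natural)

  sandwich : ∀ {Y Y′ P X B C} → Y ⇒ (P ⊗₀ X) → (X ⊗₀ B) ⇒ (X ⊗₀ C) → (P ⊗₀ X) ⇒ Y′ →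
             (Y ⊗₀ B) ⇒ (Y′ ⊗₀ C)
  sandwich l f a = (l ⊗₁ id) ⨾ α ⨾ (id ⊗₁ f) ⨾ α⁻¹ ⨾ (a ⊗₁ id)

  lam₀ : ∀ {Y X} → Y ⇒ ((Y ⊗₀ (X *)) ⊗₀ X)
  lam₀ = unitʳ⁻¹ ⨾ (id ⊗₁ twisted-η) ⨾ α⁻¹

  app₀ : ∀ {Y X} → ((Y ⊗₀ (X *)) ⊗₀ X) ⇒ Y
  app₀ = α ⨾ (id ⊗₁ ε) ⨾ unitʳ

  sandwich-lam₀-app₀ : ∀ {Y X B C} (f : (X ⊗₀ B) ⇒ (X ⊗₀ C)) →
    sandwich lam₀ f app₀ ≈ id {Y} ⊗₁ contract f
  sandwich-lam₀-app₀ {Y} {X} f = begin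
    (lam₀ ⊗₁ id) ⨾ α ⨾ (id ⊗₁ f) ⨾ α⁻¹ ⨾ (app₀ ⊗₁ id)
      ≈⟨ ⨾-resp-≈ (trans ⊗id-distrib (refl⟩⨾⟨ ⊗id-distrib))
                  (refl⟩⨾⟨ refl⟩⨾⟨ refl⟩⨾⟨ trans ⊗id-distrib (refl⟩⨾⟨ ⊗id-distrib)) ⟩
    ((unitʳ⁻¹ ⊗₁ id) ⨾ ((id ⊗₁ twisted-η) ⊗₁ id) ⨾ (α⁻¹ ⊗₁ id)) ⨾ α ⨾ (id ⊗₁ f)
      ⨾ α⁻¹ ⨾ (α ⊗₁ id) ⨾ ((id ⊗₁ ε) ⊗₁ id) ⨾ (unitʳ ⊗₁ id)
      ≈⟨ sym (pullˡ₃ refl) ⟩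
    (unitʳ⁻¹ ⊗₁ id) ⨾ ((id ⊗₁ twisted-η) ⊗₁ id) ⨾ (α⁻¹ ⊗₁ id) ⨾ α ⨾ (id ⊗₁ f)
      ⨾ α⁻¹ ⨾ (α ⊗₁ id) ⨾ ((id ⊗₁ ε) ⊗₁ id) ⨾ (unitʳ ⊗₁ id)
      ≈⟨ refl⟩⨾⟨ refl⟩⨾⟨ trans (pullˡ pentagon-α⁻¹⊗id) (sym (pullˡ₃ refl)) ⟩
    (unitʳ⁻¹ ⊗₁ id) ⨾ ((id ⊗₁ twisted-η) ⊗₁ id) ⨾ α ⨾ (id ⊗₁ α) ⨾ α⁻¹ ⨾ (id ⊗₁ f)
      ⨾ α⁻¹ ⨾ (α ⊗₁ id) ⨾ ((id ⊗₁ ε) ⊗₁ id) ⨾ (unitʳ ⊗₁ id)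
      ≈⟨ refl⟩⨾⟨ trans (pullˡ α-natural) assoc ⟩
    (unitʳ⁻¹ ⊗₁ id) ⨾ α ⨾ (id ⊗₁ (twisted-η ⊗₁ id)) ⨾ (id ⊗₁ α) ⨾ α⁻¹ ⨾ (id ⊗₁ f)
      ⨾ α⁻¹ ⨾ (α ⊗₁ id) ⨾ ((id ⊗₁ ε) ⊗₁ id) ⨾ (unitʳ ⊗₁ id)
      ≈⟨ pullˡ triangle⁻¹ ⟩
    (id ⊗₁ unitˡ⁻¹) ⨾ (id ⊗₁ (twisted-η ⊗₁ id)) ⨾ (id ⊗₁ α) ⨾ α⁻¹ ⨾ (id ⊗₁ f)
      ⨾ α⁻¹ ⨾ (α ⊗₁ id) ⨾ ((id ⊗₁ ε) ⊗₁ id) ⨾ (unitʳ ⊗₁ id)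
      ≈⟨ refl⟩⨾⟨ refl⟩⨾⟨ refl⟩⨾⟨ trans (pullˡ α⁻¹-past-id⊗f) assoc ⟩
    (id ⊗₁ unitˡ⁻¹) ⨾ (id ⊗₁ (twisted-η ⊗₁ id)) ⨾ (id ⊗₁ α) ⨾ (id ⊗₁ (id ⊗₁ f))
      ⨾ α⁻¹ ⨾ α⁻¹ ⨾ (α ⊗₁ id) ⨾ ((id ⊗₁ ε) ⊗₁ id) ⨾ (unitʳ ⊗₁ id)
      ≈⟨ refl⟩⨾⟨ refl⟩⨾⟨ refl⟩⨾⟨ refl⟩⨾⟨ trans (pullˡ₃ pentagon-α⁻¹α⁻¹) assoc ⟩
    (id ⊗₁ unitˡ⁻¹) ⨾ (id ⊗₁ (twisted-η ⊗₁ id)) ⨾ (id ⊗₁ α) ⨾ (id ⊗₁ (id ⊗₁ f))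
      ⨾ (id ⊗₁ α⁻¹) ⨾ α⁻¹ ⨾ ((id ⊗₁ ε) ⊗₁ id) ⨾ (unitʳ ⊗₁ id)
      ≈⟨ refl⟩⨾⟨ refl⟩⨾⟨ refl⟩⨾⟨ refl⟩⨾⟨ refl⟩⨾⟨ trans (pullˡ (sym α⁻¹-natural)) assoc ⟩
    (id ⊗₁ unitˡ⁻¹) ⨾ (id ⊗₁ (twisted-η ⊗₁ id)) ⨾ (id ⊗₁ α) ⨾ (id ⊗₁ (id ⊗₁ f))
      ⨾ (id ⊗₁ α⁻¹) ⨾ (id ⊗₁ (ε ⊗₁ id)) ⨾ α⁻¹ ⨾ (unitʳ ⊗₁ id)
      ≈⟨ refl⟩⨾⟨ refl⟩⨾⟨ refl⟩⨾⟨ refl⟩⨾⟨ refl⟩⨾⟨ refl⟩⨾⟨ triangle-α⁻¹ ⟩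
    (id ⊗₁ unitˡ⁻¹) ⨾ (id ⊗₁ (twisted-η ⊗₁ id)) ⨾ (id ⊗₁ α) ⨾ (id ⊗₁ (id ⊗₁ f))
      ⨾ (id ⊗₁ α⁻¹) ⨾ (id ⊗₁ (ε ⊗₁ id)) ⨾ (id ⊗₁ unitˡ)
      ≈⟨ sym id⊗-contract ⟩
    id ⊗₁ contract f
      ∎
    where
    α⁻¹-past-id⊗f : α⁻¹ ⨾ (id ⊗₁ f) ≈ (id {Y} ⊗₁ (id {X *} ⊗₁ f)) ⨾ α⁻¹
    α⁻¹-past-id⊗f = trans (refl⟩⨾⟨ ⊗-resp-≈ (sym ⊗-id) refl) (sym α⁻¹-natural)

    id⊗-contract : id {Y} ⊗₁ contract f
      ≈ (id ⊗₁ unitˡ⁻¹) ⨾ (id ⊗₁ (twisted-η ⊗₁ id)) ⨾ (id ⊗₁ α) ⨾ (id ⊗₁ (id ⊗₁ f))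
          ⨾ (id ⊗₁ α⁻¹) ⨾ (id ⊗₁ (ε ⊗₁ id)) ⨾ (id ⊗₁ unitˡ)
    id⊗-contract =
      trans id⊗-distrib (refl⟩⨾⟨ trans id⊗-distrib (refl⟩⨾⟨ trans id⊗-distrib (refl⟩⨾⟨
        trans id⊗-distrib (refl⟩⨾⟨ trans id⊗-distrib (refl⟩⨾⟨ id⊗-distrib)))))

module ReflexiveObject {o ℓ e} {𝐂 : Ribbon o ℓ e} (R : Reflexive 𝐂) where
  open Ribbon 𝐂
  open Reflexive R
  open Reasoning 𝐂
  open Coherence 𝐂
  open Contraction 𝐂

  lam≈lam₀⨾φ : lam ≈ lam₀ ⨾ (φ ⊗₁ id)
  lam≈lam₀⨾φ = trans (refl⟩⨾⟨ pullˡ₃ (sym (trans id⊗-distrib (refl⟩⨾⟨ id⊗-distrib)))) (pullˡ₃ refl)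

  -- app unfolds to (φ⁻¹ ⊗ id) ⨾ app₀ on the nose.
  sandwich-cancel-φ : ∀ {B C} (f : (A ⊗₀ B) ⇒ (A ⊗₀ C)) →
    sandwich lam f app ≈ sandwich lam₀ f app₀
  sandwich-cancel-φ f = begin
    (lam ⊗₁ id) ⨾ α ⨾ (id ⊗₁ f) ⨾ α⁻¹ ⨾ (app ⊗₁ id)
      ≈⟨ ⨾-resp-≈ (trans (⊗-resp-≈ lam≈lam₀⨾φ refl) ⊗id-distrib) (refl⟩⨾⟨ refl⟩⨾⟨ refl⟩⨾⟨ ⊗id-distrib) ⟩
    ((lam₀ ⊗₁ id) ⨾ ((φ ⊗₁ id) ⊗₁ id)) ⨾ α ⨾ (id ⊗₁ f) ⨾ α⁻¹ ⨾ ((φ⁻¹ ⊗₁ id) ⊗₁ id) ⨾ (app₀ ⊗₁ id)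
      ≈⟨ trans assoc (refl⟩⨾⟨ pullˡ₄ α-whisker-natural) ⟩
    (lam₀ ⊗₁ id) ⨾ (α ⨾ (id ⊗₁ f) ⨾ α⁻¹ ⨾ ((φ ⊗₁ id) ⊗₁ id)) ⨾ ((φ⁻¹ ⊗₁ id) ⊗₁ id) ⨾ (app₀ ⊗₁ id)
      ≈⟨ refl⟩⨾⟨ sym (pullˡ₄ refl) ⟩
    (lam₀ ⊗₁ id) ⨾ α ⨾ (id ⊗₁ f) ⨾ α⁻¹ ⨾ ((φ ⊗₁ id) ⊗₁ id) ⨾ ((φ⁻¹ ⊗₁ id) ⊗₁ id) ⨾ (app₀ ⊗₁ id)
      ≈⟨ refl⟩⨾⟨ refl⟩⨾⟨ refl⟩⨾⟨ refl⟩⨾⟨ cancelˡ (⊗id-inverse (⊗id-inverse φ-isoˡ)) ⟩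
    (lam₀ ⊗₁ id) ⨾ α ⨾ (id ⊗₁ f) ⨾ α⁻¹ ⨾ (app₀ ⊗₁ id)
      ∎

proposition4p2 : ∀ {o ℓ e} (𝐂 : Ribbon o ℓ e) (R : Reflexive 𝐂) →
    let open Ribbon 𝐂
        open Reflexive R
    in ∀ {B C} (f : (A ⊗₀ B) ⇒ (A ⊗₀ C)) →
       (lam ⊗₁ id {B}) ⨾ α ⨾ (id {A} ⊗₁ f) ⨾ α⁻¹ ⨾ (app ⊗₁ id {C})
         ≈ id {A} ⊗₁ TrL {A} {B} {C} f
proposition4p2 𝐂 R f = begin
    sandwich lam f app
      ≈⟨ sandwich-cancel-φ f ⟩
    sandwich lam₀ f app₀
      ≈⟨ sandwich-lam₀-app₀ f ⟩
    id ⊗₁ contract f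
      ≈⟨ ⊗-resp-≈ refl (TrL≈contract f) ⟨
    id ⊗₁ TrL f ∎
  where
  open Ribbon 𝐂
  open Reflexive R
  open Reasoning 𝐂
  open Contraction 𝐂
  open ReflexiveObject R
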